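{- Let $n\geq 2$. If $D$ is a defining set for the full $n$-Latin square, then $|D|=n^3(1-O(n^{ -1/2}))$; that is, there is an absolute constant $C$ such that every defining set $D$ of the full $n$-Latin square (for every $n\geq 2$) satisfies $n^3(1-Cn^{ -1/2})\leq |D|\leq n^3$.
   Context: $N(n)=\{1,\dots,n\}$. An $n$-Latin square is an $n\times n$ array whose cells are multisets of size $n$ over $N(n)$ such that each element of $N(n)$ occurs exactly $n$ times (with multiplicity) in each row and in each column; a partial $n$-Latin square is an $n\times n$ array of multisets of size at most $n$ over $N(n)$ in which each element occurs at most $n$ times in each row and column. The full $n$-Latin square is the one with $N(n)$ in every cell. A defining set for it is a partial $n$-Latin square $D$, each cell a subset of $N(n)$, such that the full $n$-Latin square is the unique $n$-Latin square $L$ with each cell of $D$ a sub-multiset of the corresponding cell of $L$. $|D|$ is the total number of entries of $D$ (sum over cells of the number of elements in the cell). -}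

module Defs where

open import Data.Nat using (ℕ; zero; suc; _+_; _*_; _≤_)
open import Data.Fin using (Fin; zero; suc)
open import Data.Fin.Subset using (Subset; _∈_; ∣_∣)
open import Relation.Binary.PropositionalEquality using (_≡_)

sumFin : ∀ {n} → (Fin n → ℕ) → ℕ
sumFin {zero}  f = 0
sumFin {suc n} f = f zero + sumFin (λ i → f (suc i))

-- A multiset over N(n) = Fin n, given by multiplicities.
Multiset : ℕ → Set
Multiset n = Fin n → ℕ

-- An n×n array of multisets over N(n): cell (row i, column j).
Array : ℕ → Set
Array n = Fin n → Fin n → Multiset n

IsLatin : ∀ n → Array n → Set
IsLatin n L =
  (∀ i j → sumFin (λ k → L i j k) ≡ n) ×'
  ((∀ i k → sumFin (λ j → L i j k) ≡ n) ×'
   (∀ j k → sumFin (λ i → L i j k) ≡ n))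
  where
  open import Data.Product using () renaming (_×_ to _×'_)

Full : ∀ n → Array n
Full n i j k = 1

-- A partial n-Latin square whose cells are subsets of N(n).
-- (Cell size ≤ n and "each symbol at most n times per row/column"
-- hold automatically for subsets of N(n) in an n×n array.)
SubsetArray : ℕ → Set
SubsetArray n = Fin n → Fin n → Subset n

size : ∀ {n} → SubsetArray n → ℕ
size D = sumFin (λ i → sumFin (λ j → ∣ D i j ∣))

Contains : ∀ {n} → Array n → SubsetArray n → Set
Contains L D = ∀ i j k → k ∈ D i j → 1 ≤ L i j k

IsDefiningSetFull : ∀ n → SubsetArray n → Set
IsDefiningSetFull n D =
  ∀ (L : Array n) → IsLatin n L → Contains L D → ∀ i j k → L i j k ≡ Full n i j k

module Submission where

-- Every defining set D of the full n-Latin square satisfies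
-- (n³ − |D|)² ≤ 3n⁵ ≤ 2²·n⁵, i.e. corollary2p3 holds with C = 2.
--
-- Two rows i₁ ≠ i₂ of D determine the bipartite "common-gap" graph joining
-- column j to symbol k when k is missing from both D(i₁,j) and D(i₂,j).  A
-- cycle in it is a trade: shifting the cycle's symbols alternately between
-- rows i₁ and i₂ gives another n-Latin square containing D.  So for a defining
-- set this graph has no cycle, hence at most 2n edges (peel off vertices of
-- degree ≤ 1; once all degrees are ≥ 2, a non-backtracking walk closes a cycle).
-- With g(j,k) the number of rows whose cell j misses k, Σ g = n³ − |D| and
-- Σ g² = Σ_{i₁,i₂} (common gaps of i₁, i₂) ≤ n·n² + n²·2n; Cauchy–Schwarz ends it.

open import Defs
open import Data.Bool using (Bool; true; false; not; _∧_; T)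
open import Data.Bool.Properties using (T?; T-∧)
open import Data.Empty using (⊥; ⊥-elim)
open import Data.Fin using (Fin; zero; suc; toℕ; fromℕ<)
open import Data.Fin.Instances
open import Data.Fin.Properties using (toℕ<n; toℕ-fromℕ<; any?)
open import Data.Fin.Subset using (Subset; _∈_; ∣_∣)
open import Data.Nat using (ℕ; zero; suc; _+_; _*_; _∸_; _^_; _≤_; _<_; z≤n; s≤s; z<s; _≤?_)
open import Data.Nat.Properties hiding (_≟_)
open import Data.Nat.Solver using (module +-*-Solver)
open import Data.Product using (Σ; _×_; _,_; ∃; proj₁; proj₂)
open import Data.Sum using (_⊎_; inj₁; inj₂)
open import Data.Sum.Instances
open import Data.Sum.Properties using (inj₁-injective; inj₂-injective)
open import Data.Unit using (tt)
open import Data.Vec using ([]; _∷_; lookup)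
open import Data.Vec.Properties using ([]=⇒lookup)
open import Function using (_∘_; Equivalence)
open import Relation.Binary.Definitions using (tri<; tri≈; tri>)
open import Relation.Binary.PropositionalEquality
open import Relation.Binary.TypeClasses using (IsDecEquivalence; _≟_)
open import Relation.Nullary using (¬_; Dec; yes; no; does)
open import Relation.Nullary.Decidable using (_×-dec_)
open import Algebra.Properties.Semiring.Sum +-*-semiring
  using (sum; sum-cong-≗; ∑-distrib-+; ∑-comm; *-distribˡ-sum)

χ : Bool → ℕ
χ true  = 1
χ false = 0

χ≤1 : ∀ b → χ b ≤ 1
χ≤1 true  = s≤s z≤n
χ≤1 false = z≤n

χ-∧ : ∀ a b → χ (a ∧ b) ≡ χ a * χ b
χ-∧ true  true  = refl
χ-∧ true  false = refl
χ-∧ false b     = refl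

χ-pos : ∀ b → 0 < χ b → T b
χ-pos true _ = tt

T⇒χ≡1 : ∀ b → T b → χ b ≡ 1
T⇒χ≡1 true _ = refl

χ-weight : ∀ b (m : ℕ) → T b → χ b * m ≡ m
χ-weight true m _ = +-identityʳ m

split-∧ : ∀ {a b} → T (a ∧ b) → T a × T b
split-∧ = Equivalence.to T-∧

module _ {A : Set} {{_ : IsDecEquivalence {A = A} _≡_}} where

  δ : A → A → ℕ
  δ x y = χ (does (x ≟ y))

  δ-refl : ∀ x → δ x x ≡ 1
  δ-refl x with x ≟ x
  ... | yes _   = refl
  ... | no x≢x = ⊥-elim (x≢x refl)

  δ-≢ : ∀ {x y} → x ≢ y → δ x y ≡ 0
  δ-≢ {x} {y} x≢y with x ≟ y
  ... | yes x≡y = ⊥-elim (x≢y x≡y)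
  ... | no _    = refl

  δ≤1 : ∀ x y → δ x y ≤ 1
  δ≤1 x y = χ≤1 (does (x ≟ y))

  δ-pos : ∀ {x y} → 0 < δ x y → x ≡ y
  δ-pos {x} {y} p with x ≟ y
  ... | yes x≡y = x≡y

sumFin≡sum : ∀ {n} (f : Fin n → ℕ) → sumFin f ≡ sum f
sumFin≡sum {zero}  f = refl
sumFin≡sum {suc n} f = cong (f zero +_) (sumFin≡sum (λ x → f (suc x)))

sumFin-cong : ∀ {n} {f g : Fin n → ℕ} → (∀ x → f x ≡ g x) → sumFin f ≡ sumFin g
sumFin-cong {f = f} {g} f≗g =
  trans (sumFin≡sum f) (trans (sum-cong-≗ f≗g) (sym (sumFin≡sum g)))

sumFin-mono : ∀ {n} {f g : Fin n → ℕ} → (∀ x → f x ≤ g x) → sumFin f ≤ sumFin g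
sumFin-mono {zero}  f≤g = z≤n
sumFin-mono {suc n} f≤g = +-mono-≤ (f≤g zero) (sumFin-mono (λ x → f≤g (suc x)))

sumFin-+ : ∀ {n} (f g : Fin n → ℕ) → sumFin (λ x → f x + g x) ≡ sumFin f + sumFin g
sumFin-+ f g = begin
  sumFin (λ x → f x + g x)  ≡⟨ sumFin≡sum (λ x → f x + g x) ⟩
  sum (λ x → f x + g x)     ≡⟨ ∑-distrib-+ f g ⟩
  sum f + sum g             ≡⟨ sym (cong₂ _+_ (sumFin≡sum f) (sumFin≡sum g)) ⟩
  sumFin f + sumFin g       ∎
  where open ≡-Reasoning

sumFin-*ˡ : ∀ {n} (c : ℕ) (f : Fin n → ℕ) → sumFin (λ x → c * f x) ≡ c * sumFin f
sumFin-*ˡ c f = begin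
  sumFin (λ x → c * f x)  ≡⟨ sumFin≡sum (λ x → c * f x) ⟩
  sum (λ x → c * f x)     ≡⟨ sym (*-distribˡ-sum c f) ⟩
  c * sum f               ≡⟨ cong (c *_) (sym (sumFin≡sum f)) ⟩
  c * sumFin f            ∎
  where open ≡-Reasoning

sumFin-*ʳ : ∀ {n} (c : ℕ) (f : Fin n → ℕ) → sumFin (λ x → f x * c) ≡ sumFin f * c
sumFin-*ʳ c f =
  trans (sumFin-cong (λ x → *-comm (f x) c)) (trans (sumFin-*ˡ c f) (*-comm c _))

sumFin-swap : ∀ {m n} (f : Fin m → Fin n → ℕ) →
  sumFin (λ x → sumFin (λ y → f x y)) ≡ sumFin (λ y → sumFin (λ x → f x y))
sumFin-swap f = begin
  sumFin (λ x → sumFin (λ y → f x y))  ≡⟨ as-sum f ⟩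
  sum (λ x → sum (λ y → f x y))        ≡⟨ ∑-comm f ⟩
  sum (λ y → sum (λ x → f x y))        ≡⟨ sym (as-sum (λ y x → f x y)) ⟩
  sumFin (λ y → sumFin (λ x → f x y))  ∎
  where
  open ≡-Reasoning
  as-sum : ∀ {m n} (g : Fin m → Fin n → ℕ) →
    sumFin (λ x → sumFin (g x)) ≡ sum (λ x → sum (g x))
  as-sum g = trans (sumFin-cong (λ x → sumFin≡sum (g x))) (sumFin≡sum (λ x → sum (g x)))

sumFin-const : ∀ {n} (c : ℕ) → sumFin {n} (λ _ → c) ≡ n * c
sumFin-const {zero}  c = refl
sumFin-const {suc n} c = cong (c +_) (sumFin-const {n} c)

sumFin-ones : ∀ {n} → sumFin {n} (λ _ → 1) ≡ n
sumFin-ones {n} = trans (sumFin-const {n} 1) (*-identityʳ n)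

sumFin-zeros : ∀ {n} → sumFin {n} (λ _ → 0) ≡ 0
sumFin-zeros {n} = trans (sumFin-const {n} 0) (*-zeroʳ n)

sumFin-δ : ∀ {n} (x₀ : Fin n) (c : Fin n → ℕ) → sumFin (λ x → δ x₀ x * c x) ≡ c x₀
sumFin-δ {suc n} zero     c =
  trans (cong (c zero + 0 +_) (sumFin-zeros {n})) (trans (+-identityʳ _) (+-identityʳ (c zero)))
sumFin-δ {suc n} (suc x₀) c = sumFin-δ x₀ (λ x → c (suc x))

sumFin-unit : ∀ {n} (x₀ : Fin n) → sumFin (δ x₀) ≡ 1
sumFin-unit x₀ =
  trans (sumFin-cong (λ x → sym (*-identityʳ (δ x₀ x)))) (sumFin-δ x₀ (λ _ → 1))

sumFin-term : ∀ {n} (f : Fin n → ℕ) x → f x ≤ sumFin f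
sumFin-term f zero    = m≤m+n _ _
sumFin-term f (suc x) = ≤-trans (sumFin-term (λ y → f (suc y)) x) (m≤n+m _ _)

sumFin-pos : ∀ {n} (f : Fin n → ℕ) → 0 < sumFin f → ∃ λ x → 0 < f x
sumFin-pos {suc n} f p with f zero in eq
... | suc _ = zero , subst (0 <_) (sym eq) z<s
... | zero  = let x , fx>0 = sumFin-pos (λ x → f (suc x)) p in suc x , fx>0

sumFin-mul : ∀ {m n} (f : Fin m → ℕ) (g : Fin n → ℕ) →
  sumFin f * sumFin g ≡ sumFin (λ x → sumFin (λ y → f x * g y))
sumFin-mul f g =
  trans (sym (sumFin-*ʳ (sumFin g) f)) (sumFin-cong (λ x → sym (sumFin-*ˡ (f x) g)))

double-product≤squares-ordered : ∀ a b → a ≤ b → a * b + a * b ≤ a * a + b * b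
double-product≤squares-ordered a b a≤b =
  subst₂ _≤_ (cong (λ z → a * z + a * z) a+d≡b) (cong (λ z → a * a + z * z) a+d≡b)
    (≤-trans (m≤m+n _ (d * d)) (≤-reflexive
      (solve 2 (λ a d → a :* (a :+ d) :+ a :* (a :+ d) :+ d :* d := a :* a :+ (a :+ d) :* (a :+ d))
             refl a d)))
  where
  open +-*-Solver
  d : ℕ
  d = b ∸ a
  a+d≡b : a + d ≡ b
  a+d≡b = m+[n∸m]≡n a≤b

double-product≤squares : ∀ a b → a * b + a * b ≤ a * a + b * b
double-product≤squares a b with ≤-total a b
... | inj₁ a≤b = double-product≤squares-ordered a b a≤b
... | inj₂ b≤a = subst₂ _≤_ (cong₂ _+_ (*-comm b a) (*-comm b a)) (+-comm (b * b) (a * a))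
                   (double-product≤squares-ordered b a b≤a)

halve : ∀ {a b} → a + a ≤ b + b → a ≤ b
halve a+a≤b+b = ≮⇒≥ (λ b<a → <⇒≱ (+-mono-< b<a b<a) a+a≤b+b)

cauchy-schwarz : ∀ {N} (f : Fin N → ℕ) → sumFin f * sumFin f ≤ N * sumFin (λ x → f x * f x)
cauchy-schwarz {N} f = subst (_≤ N * Σf²) (sym (sumFin-mul f f)) (halve doubled)
  where
  open ≤-Reasoning
  Σf² S : ℕ
  Σf² = sumFin (λ x → f x * f x)
  S = sumFin (λ x → sumFin (λ y → f x * f y))
  doubled : S + S ≤ N * Σf² + N * Σf²
  doubled = begin
    S + S
      ≡⟨ sym (sumFin-+ (λ x → sumFin (λ y → f x * f y)) _) ⟩
    sumFin (λ x → sumFin (λ y → f x * f y) + sumFin (λ y → f x * f y))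
      ≡⟨ sumFin-cong (λ x → sym (sumFin-+ (λ y → f x * f y) (λ y → f x * f y))) ⟩
    sumFin (λ x → sumFin (λ y → f x * f y + f x * f y))
      ≤⟨ sumFin-mono (λ x → sumFin-mono (λ y → double-product≤squares (f x) (f y))) ⟩
    sumFin (λ x → sumFin (λ y → f x * f x + f y * f y))
      ≡⟨ sumFin-cong (λ x → sumFin-+ (λ _ → f x * f x) (λ y → f y * f y)) ⟩
    sumFin (λ x → sumFin {N} (λ _ → f x * f x) + Σf²)
      ≡⟨ sumFin-+ (λ x → sumFin {N} (λ _ → f x * f x)) (λ _ → Σf²) ⟩
    sumFin (λ x → sumFin {N} (λ _ → f x * f x)) + sumFin {N} (λ _ → Σf²)
      ≡⟨ cong₂ _+_ (trans (sumFin-cong (λ x → sumFin-const {N} (f x * f x)))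
                          (sumFin-*ˡ N (λ x → f x * f x)))
                   (sumFin-const {N} Σf²) ⟩
    N * Σf² + N * Σf² ∎

cauchy-schwarz² : ∀ {m n} (f : Fin m → Fin n → ℕ) →
  let Σf = sumFin (λ x → sumFin (f x)) in
  Σf * Σf ≤ m * (n * sumFin (λ x → sumFin (λ y → f x y * f x y)))
cauchy-schwarz² {m} {n} f = begin
  sumFin (λ x → sumFin (f x)) * sumFin (λ x → sumFin (f x))
    ≤⟨ cauchy-schwarz (λ x → sumFin (f x)) ⟩
  m * sumFin (λ x → sumFin (f x) * sumFin (f x))
    ≤⟨ *-monoʳ-≤ m (sumFin-mono (λ x → cauchy-schwarz (f x))) ⟩
  m * sumFin (λ x → n * sumFin (λ y → f x y * f x y))
    ≡⟨ cong (m *_) (sumFin-*ˡ n (λ x → sumFin (λ y → f x y * f x y))) ⟩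
  m * (n * sumFin (λ x → sumFin (λ y → f x y * f x y))) ∎
  where open ≤-Reasoning

sumBelow : ℕ → (ℕ → ℕ) → ℕ
sumBelow ℓ f = sumFin {ℓ} (λ a → f (toℕ a))

sumBelow-last : ∀ ℓ (f : ℕ → ℕ) → sumBelow (suc ℓ) f ≡ sumBelow ℓ f + f ℓ
sumBelow-last zero    f = +-comm (f 0) 0
sumBelow-last (suc ℓ) f =
  trans (cong (f 0 +_) (sumBelow-last ℓ (λ a → f (suc a))))
        (sym (+-assoc (f 0) (sumBelow ℓ (λ a → f (suc a))) (f (suc ℓ))))

sumBelow-cong : ∀ ℓ {f g : ℕ → ℕ} → (∀ a → a < ℓ → f a ≡ g a) →
  sumBelow ℓ f ≡ sumBelow ℓ g
sumBelow-cong ℓ f≗g = sumFin-cong (λ a → f≗g (toℕ a) (toℕ<n a))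

sumBelow-zero : ∀ ℓ {f : ℕ → ℕ} → (∀ a → a < ℓ → f a ≡ 0) → sumBelow ℓ f ≡ 0
sumBelow-zero ℓ f≗0 = trans (sumBelow-cong ℓ f≗0) (sumFin-zeros {ℓ})

sumBelow-rotate : ∀ ℓ (f : ℕ → ℕ) → f ℓ ≡ f 0 → sumBelow ℓ (λ a → f (suc a)) ≡ sumBelow ℓ f
sumBelow-rotate ℓ f fℓ≡f0 = +-cancelʳ-≡ (f 0) _ _ (begin
  sumBelow ℓ (λ a → f (suc a)) + f 0  ≡⟨ +-comm _ (f 0) ⟩
  sumBelow (suc ℓ) f                  ≡⟨ sumBelow-last ℓ f ⟩
  sumBelow ℓ f + f ℓ                  ≡⟨ cong (sumBelow ℓ f +_) fℓ≡f0 ⟩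
  sumBelow ℓ f + f 0                  ∎)
  where open ≡-Reasoning

sumBelow-term : ∀ {ℓ} (f : ℕ → ℕ) {a} → a < ℓ → f a ≤ sumBelow ℓ f
sumBelow-term {ℓ} f a<ℓ = subst (λ b → f b ≤ sumBelow ℓ f) (toℕ-fromℕ< a<ℓ)
  (sumFin-term (λ b → f (toℕ b)) (fromℕ< a<ℓ))

sumBelow-pos : ∀ ℓ (f : ℕ → ℕ) → 0 < sumBelow ℓ f → ∃ λ a → a < ℓ × 0 < f a
sumBelow-pos ℓ f p = let a , fa>0 = sumFin-pos (λ a → f (toℕ a)) p in toℕ a , toℕ<n a , fa>0

-- The vertices of a bipartite graph whose two sides are copies of Fin n:
-- inj₁ j is a left vertex (later: a column), inj₂ k a right one (a symbol).
Vertex : ℕ → Set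
Vertex n = Fin n ⊎ Fin n

sumV : ∀ {n} → (Vertex n → ℕ) → ℕ
sumV g = sumFin (λ j → g (inj₁ j)) + sumFin (λ k → g (inj₂ k))

sumV-mono : ∀ {n} {f g : Vertex n → ℕ} → (∀ v → f v ≤ g v) → sumV f ≤ sumV g
sumV-mono f≤g = +-mono-≤ (sumFin-mono (f≤g ∘ inj₁)) (sumFin-mono (f≤g ∘ inj₂))

sumV-ones : ∀ {n} → sumV {n} (λ _ → 1) ≡ n + n
sumV-ones {n} = cong₂ _+_ (sumFin-ones {n}) (sumFin-ones {n})

sumV-δ : ∀ {n} (u : Vertex n) → sumV (δ u) ≡ 1
sumV-δ {n} (inj₁ j) = cong₂ _+_ (sumFin-unit j) (sumFin-zeros {n})
sumV-δ {n} (inj₂ k) = cong₂ _+_ (sumFin-zeros {n}) (sumFin-unit k)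

sumV-swap : ∀ {m n} (F : Fin m → Vertex n → ℕ) →
  sumV (λ w → sumFin (λ a → F a w)) ≡ sumFin (λ a → sumV (F a))
sumV-swap F = trans
  (cong₂ _+_ (sumFin-swap (λ j a → F a (inj₁ j))) (sumFin-swap (λ k a → F a (inj₂ k))))
  (sym (sumFin-+ (λ a → sumFin (λ j → F a (inj₁ j))) (λ a → sumFin (λ k → F a (inj₂ k)))))

sumV-*ˡ : ∀ {n} (c : ℕ) (g : Vertex n → ℕ) → sumV (λ w → c * g w) ≡ c * sumV g
sumV-*ˡ c g = trans (cong₂ _+_ (sumFin-*ˡ c (g ∘ inj₁)) (sumFin-*ˡ c (g ∘ inj₂)))
                    (sym (*-distribˡ-+ c (sumFin (g ∘ inj₁)) (sumFin (g ∘ inj₂))))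

sumV-*ʳ : ∀ {n} (c : ℕ) (g : Vertex n → ℕ) → sumV (λ w → g w * c) ≡ sumV g * c
sumV-*ʳ c g = trans (cong₂ _+_ (sumFin-*ʳ c (g ∘ inj₁)) (sumFin-*ʳ c (g ∘ inj₂)))
                    (sym (*-distribʳ-+ c (sumFin (g ∘ inj₁)) (sumFin (g ∘ inj₂))))

sumV-right : ∀ {n} (g : Vertex n → ℕ) → (∀ j → g (inj₁ j) ≡ 0) → sumV g ≡ sumFin (g ∘ inj₂)
sumV-right {n} g left≡0 = cong (_+ sumFin (g ∘ inj₂)) (trans (sumFin-cong left≡0) (sumFin-zeros {n}))

sumV-left : ∀ {n} (g : Vertex n → ℕ) → (∀ k → g (inj₂ k) ≡ 0) → sumV g ≡ sumFin (g ∘ inj₁)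
sumV-left {n} g right≡0 =
  trans (cong (sumFin (g ∘ inj₁) +_) (trans (sumFin-cong right≡0) (sumFin-zeros {n}))) (+-identityʳ _)

Distinct : ∀ {A : Set} → (ℕ → A) → ℕ → Set
Distinct y ℓ = ∀ a b → a < b → b < ℓ → y a ≢ y b

distinct-shorter : ∀ {A : Set} {y : ℕ → A} {ℓ} → Distinct y (suc ℓ) → Distinct y ℓ
distinct-shorter d a b a<b b<ℓ = d a b a<b (m<n⇒m<1+n b<ℓ)

distinct-injective : ∀ {A : Set} {y : ℕ → A} {ℓ} → Distinct y ℓ →
  ∀ {a b} → a < ℓ → b < ℓ → y a ≡ y b → a ≡ b
distinct-injective d {a} {b} a<ℓ b<ℓ ya≡yb with <-cmp a b
... | tri< a<b _ _ = ⊥-elim (d a b a<b b<ℓ ya≡yb)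
... | tri≈ _ a≡b _ = a≡b
... | tri> _ _ b<a = ⊥-elim (d b a b<a a<ℓ (sym ya≡yb))

module _ {A : Set} {{_ : IsDecEquivalence {A = A} _≡_}} where

  visits : (ℕ → A) → ℕ → A → ℕ
  visits y ℓ v = sumBelow ℓ (λ a → δ (y a) v)

  visits≤1 : ∀ (y : ℕ → A) ℓ → Distinct y ℓ → ∀ v → visits y ℓ v ≤ 1
  visits≤1 y zero    d v = z≤n
  visits≤1 y (suc ℓ) d v with y ℓ ≟ v
  ... | yes refl = begin
    visits y (suc ℓ) (y ℓ)            ≡⟨ sumBelow-last ℓ (λ a → δ (y a) (y ℓ)) ⟩
    visits y ℓ (y ℓ) + δ (y ℓ) (y ℓ)  ≡⟨ cong₂ _+_ earlier-absent (δ-refl (y ℓ)) ⟩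
    1                                 ∎
    where
    open ≤-Reasoning
    earlier-absent : visits y ℓ (y ℓ) ≡ 0
    earlier-absent = sumBelow-zero ℓ (λ a a<ℓ → δ-≢ (d a ℓ a<ℓ ≤-refl))
  ... | no yℓ≢v = begin
    visits y (suc ℓ) v        ≡⟨ sumBelow-last ℓ (λ a → δ (y a) v) ⟩
    visits y ℓ v + δ (y ℓ) v  ≡⟨ cong (visits y ℓ v +_) (δ-≢ yℓ≢v) ⟩
    visits y ℓ v + 0          ≡⟨ +-identityʳ _ ⟩
    visits y ℓ v              ≤⟨ visits≤1 y ℓ (distinct-shorter d) v ⟩
    1                         ∎
    where open ≤-Reasoning

visits-total : ∀ {n} (y : ℕ → Vertex n) ℓ → sumV (visits y ℓ) ≡ ℓ
visits-total y ℓ = begin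
  sumV (λ v → sumBelow ℓ (λ a → δ (y a) v))  ≡⟨ sumV-swap {ℓ} (λ a v → δ (y (toℕ a)) v) ⟩
  sumBelow ℓ (λ a → sumV (δ (y a)))          ≡⟨ sumBelow-cong ℓ (λ a _ → sumV-δ (y a)) ⟩
  sumBelow ℓ (λ _ → 1)                       ≡⟨ sumFin-ones {ℓ} ⟩
  ℓ                                          ∎
  where open ≡-Reasoning

distinct-length : ∀ {n} (y : ℕ → Vertex n) ℓ → Distinct y ℓ → ℓ ≤ n + n
distinct-length {n} y ℓ d = begin
  ℓ                     ≡⟨ sym (visits-total y ℓ) ⟩
  sumV (visits y ℓ)     ≤⟨ sumV-mono (visits≤1 y ℓ d) ⟩
  sumV {n} (λ _ → 1)    ≡⟨ sumV-ones {n} ⟩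
  n + n                 ∎
  where open ≤-Reasoning

least-below : ∀ {P : ℕ → Set} → (∀ t → Dec (P t)) → ∀ N →
  (∀ t → t < N → ¬ P t) ⊎ (∃ λ t → t < N × P t × (∀ u → u < t → ¬ P u))
least-below P? zero = inj₁ (λ _ ())
least-below {P} P? (suc N) with least-below P? N
... | inj₂ (t , t<N , Pt , least) = inj₂ (t , m<n⇒m<1+n t<N , Pt , least)
... | inj₁ none-below with P? N
...   | yes PN = inj₂ (N , ≤-refl , PN , none-below)
...   | no ¬PN = inj₁ none-up-to-N
  where
  none-up-to-N : ∀ t → t < suc N → ¬ P t
  none-up-to-N t t<1+N with m<1+n⇒m<n∨m≡n t<1+N
  ... | inj₁ t<N  = none-below t t<N
  ... | inj₂ refl = ¬PN

Adj : ∀ {n} → (Fin n → Fin n → Bool) → Vertex n → Vertex n → Set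
Adj H (inj₁ j) (inj₂ k) = T (H j k)
Adj H (inj₂ k) (inj₁ j) = T (H j k)
Adj H (inj₁ _) (inj₁ _) = ⊥
Adj H (inj₂ _) (inj₂ _) = ⊥

Adj-irreflexive : ∀ {n} (H : Fin n → Fin n → Bool) u → ¬ Adj H u u
Adj-irreflexive H (inj₁ _) ()
Adj-irreflexive H (inj₂ _) ()

record Cycle {n} (H : Fin n → Fin n → Bool) : Set where
  field
    length   : ℕ
    vertex   : ℕ → Vertex n
    long     : 3 ≤ length
    closed   : vertex length ≡ vertex 0
    distinct : Distinct vertex length
    step     : ∀ a → a < length → Adj H (vertex a) (vertex (suc a))

-- A walk that never immediately returns to the vertex it came from contains
-- a cycle: cut it at the first revisit of a vertex, which happens within
-- 2n + 1 steps by pigeonhole.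
module _ {n} (H : Fin n → Fin n → Bool) (x : ℕ → Vertex n)
         (x-step : ∀ t → Adj H (x t) (x (suc t)))
         (x-no-return : ∀ t → x (suc (suc t)) ≢ x t) where

  return-time≥3 : ∀ s ℓ → 0 < ℓ → x (s + ℓ) ≡ x s → 3 ≤ ℓ
  return-time≥3 s 1 _ returns =
    ⊥-elim (Adj-irreflexive H (x s) (subst (Adj H (x s)) (trans (cong x (+-comm 1 s)) returns) (x-step s)))
  return-time≥3 s 2 _ returns =
    ⊥-elim (x-no-return s (trans (cong x (+-comm 2 s)) returns))
  return-time≥3 s (suc (suc (suc _))) _ _ = s≤s (s≤s (s≤s z≤n))

  walk⇒cycle : Cycle H
  walk⇒cycle with least-below (λ t → anyUpTo? (λ s → x s ≟ x t) t) (suc (n + n))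
  ... | inj₁ no-revisit = ⊥-elim (<-irrefl refl
          (distinct-length x (suc (n + n)) (λ a b a<b b<N xa≡xb → no-revisit b b<N (a , a<b , xa≡xb))))
  ... | inj₂ (t , _ , (s , s<t , xs≡xt) , first-revisit) = record
    { length   = t ∸ s
    ; vertex   = λ a → x (s + a)
    ; long     = return-time≥3 s (t ∸ s) (m<n⇒0<n∸m s<t) returns
    ; closed   = trans returns (cong x (sym (+-identityʳ s)))
    ; distinct = λ a b a<b b<ℓ → distinct-before-t (s + a) (s + b) (+-monoʳ-< s a<b)
                                    (subst (s + b <_) s+ℓ≡t (+-monoʳ-< s b<ℓ))
    ; step     = λ a _ → subst (λ z → Adj H (x (s + a)) (x z)) (sym (+-suc s a)) (x-step (s + a))
    }
    where
    s+ℓ≡t : s + (t ∸ s) ≡ t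
    s+ℓ≡t = m+[n∸m]≡n (<⇒≤ s<t)
    returns : x (s + (t ∸ s)) ≡ x s
    returns = trans (cong x s+ℓ≡t) (sym xs≡xt)
    distinct-before-t : Distinct x t
    distinct-before-t a b a<b b<t xa≡xb = first-revisit b b<t (a , a<b , xa≡xb)

count : ∀ {n} → (Fin n → Bool) → ℕ
count R = sumFin (λ x → χ (R x))

remove : ∀ {n} → (Fin n → Bool) → Fin n → Fin n → Bool
remove R x₀ x = R x ∧ not (does (x₀ ≟ x))

remove-T : ∀ {n} (R : Fin n → Bool) x₀ x → T (remove R x₀ x) → T (R x) × x ≢ x₀
remove-T R x₀ x t with x₀ ≟ x | R x
... | no x₀≢x | true = tt , x₀≢x ∘ sym

sum-remove : ∀ {n} (R : Fin n → Bool) x₀ (F : Fin n → ℕ) →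
  sumFin (λ x → χ (R x) * F x) ≡ sumFin (λ x → χ (remove R x₀ x) * F x) + χ (R x₀) * F x₀
sum-remove R x₀ F = begin
  sumFin (λ x → χ (R x) * F x)
    ≡⟨ sumFin-cong pointwise ⟩
  sumFin (λ x → χ (remove R x₀ x) * F x + δ x₀ x * (χ (R x₀) * F x₀))
    ≡⟨ sumFin-+ (λ x → χ (remove R x₀ x) * F x) _ ⟩
  sumFin (λ x → χ (remove R x₀ x) * F x) + sumFin (λ x → δ x₀ x * (χ (R x₀) * F x₀))
    ≡⟨ cong (sumFin (λ x → χ (remove R x₀ x) * F x) +_) (sumFin-δ x₀ (λ _ → χ (R x₀) * F x₀)) ⟩
  sumFin (λ x → χ (remove R x₀ x) * F x) + χ (R x₀) * F x₀ ∎
  where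
  open ≡-Reasoning
  pointwise : ∀ x → χ (R x) * F x ≡ χ (remove R x₀ x) * F x + δ x₀ x * (χ (R x₀) * F x₀)
  pointwise x with x₀ ≟ x
  ... | yes refl with R x₀
  ...   | true  = sym (+-identityʳ (F x₀ + 0))
  ...   | false = refl
  pointwise x | no _ with R x
  ...   | true  = sym (+-identityʳ (F x + 0))
  ...   | false = refl

count-split : ∀ {n} (R : Fin n → Bool) x₀ → count R ≡ count (remove R x₀) + χ (R x₀)
count-split R x₀ = begin
  count R                     ≡⟨ sumFin-cong (λ x → sym (*-identityʳ (χ (R x)))) ⟩
  sumFin (λ x → χ (R x) * 1)  ≡⟨ sum-remove R x₀ (λ _ → 1) ⟩
  sumFin (λ x → χ (remove R x₀ x) * 1) + χ (R x₀) * 1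
    ≡⟨ cong₂ _+_ (sumFin-cong (λ x → *-identityʳ (χ (remove R x₀ x)))) (*-identityʳ (χ (R x₀))) ⟩
  count (remove R x₀) + χ (R x₀) ∎
  where open ≡-Reasoning

count-remove : ∀ {n} (R : Fin n → Bool) x₀ → T (R x₀) → count R ≡ suc (count (remove R x₀))
count-remove R x₀ Rx₀ =
  trans (count-split R x₀) (trans (cong (count (remove R x₀) +_) (T⇒χ≡1 (R x₀) Rx₀)) (+-comm _ 1))

another-point : ∀ {n} (g : Fin n → Bool) x₀ → 2 ≤ count g → ∃ λ x → x ≢ x₀ × T (g x)
another-point g x₀ two =
  let x , positive = sumFin-pos (λ x → χ (remove g x₀ x)) rest-positive
      gx , x≢x₀    = remove-T g x₀ x (χ-pos _ positive)
  in x , x≢x₀ , gx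
  where
  rest-positive : 1 ≤ count (remove g x₀)
  rest-positive = ≤-pred (begin
    2                                   ≤⟨ two ⟩
    count g                             ≡⟨ count-split g x₀ ⟩
    count (remove g x₀) + χ (g x₀)      ≤⟨ +-monoʳ-≤ (count (remove g x₀)) (χ≤1 (g x₀)) ⟩
    count (remove g x₀) + 1             ≡⟨ +-comm _ 1 ⟩
    suc (count (remove g x₀))           ∎)
    where open ≤-Reasoning

-- We track the subgraph induced by active left vertices R and active
-- right vertices K, repeatedly deleting an active vertex of active degree ≤ 1
-- (which loses one vertex and at most one edge).  When no such vertex is
-- left, every active vertex has two active neighbours, and a walk that never
-- turns back finds a cycle.
module Peeling {n} (H : Fin n → Fin n → Bool) where

  degL : (K : Fin n → Bool) → Fin n → ℕ
  degL K j = count (λ k → K k ∧ H j k)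

  degR : (R : Fin n → Bool) → Fin n → ℕ
  degR R k = count (λ j → R j ∧ H j k)

  edges : (R K : Fin n → Bool) → ℕ
  edges R K = sumFin (λ j → χ (R j) * degL K j)

  order : (R K : Fin n → Bool) → ℕ
  order R K = count R + count K

  edges-by-right : ∀ R K → edges R K ≡ sumFin (λ k → χ (K k) * degR R k)
  edges-by-right R K = begin
    sumFin (λ j → χ (R j) * degL K j)
      ≡⟨ sumFin-cong (λ j → sym (sumFin-*ˡ (χ (R j)) (λ k → χ (K k ∧ H j k)))) ⟩
    sumFin (λ j → sumFin (λ k → χ (R j) * χ (K k ∧ H j k)))
      ≡⟨ sumFin-swap (λ j k → χ (R j) * χ (K k ∧ H j k)) ⟩
    sumFin (λ k → sumFin (λ j → χ (R j) * χ (K k ∧ H j k)))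
      ≡⟨ sumFin-cong (λ k → sumFin-cong (λ j → exchange (R j) (K k) (H j k))) ⟩
    sumFin (λ k → sumFin (λ j → χ (K k) * χ (R j ∧ H j k)))
      ≡⟨ sumFin-cong (λ k → sumFin-*ˡ (χ (K k)) (λ j → χ (R j ∧ H j k))) ⟩
    sumFin (λ k → χ (K k) * degR R k) ∎
    where
    open ≡-Reasoning
    exchange : ∀ r c h → χ r * χ (c ∧ h) ≡ χ c * χ (r ∧ h)
    exchange true  true  h = refl
    exchange true  false h = refl
    exchange false true  h = refl
    exchange false false h = refl

  edges-witness : ∀ R K → 0 < edges R K → ∃ λ j → ∃ λ k → T (R j) × T (K k) × T (H j k)
  edges-witness R K p with sumFin-pos (λ j → χ (R j) * degL K j) p
  ... | j , q with R j in Rj≡true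
  ...   | true =
    let k , r   = sumFin-pos (λ k → χ (K k ∧ H j k)) (subst (0 <_) (+-identityʳ _) q)
        Kk , Hjk = split-∧ (χ-pos _ r)
    in j , k , subst T (sym Rj≡true) tt , Kk , Hjk

  order-remove-left : ∀ R K j → T (R j) → order R K ≡ suc (order (remove R j) K)
  order-remove-left R K j Rj = cong (_+ count K) (count-remove R j Rj)

  order-remove-right : ∀ R K k → T (K k) → order R K ≡ suc (order R (remove K k))
  order-remove-right R K k Kk = trans (cong (count R +_) (count-remove K k Kk)) (+-suc _ _)

  edges-remove-left : ∀ R K j → T (R j) → edges R K ≡ edges (remove R j) K + degL K j
  edges-remove-left R K j Rj =
    trans (sum-remove R j (degL K)) (cong (edges (remove R j) K +_) (χ-weight (R j) _ Rj))

  edges-remove-right : ∀ R K k → T (K k) → edges R K ≡ edges R (remove K k) + degR R k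
  edges-remove-right R K k Kk = begin
    edges R K                                                    ≡⟨ edges-by-right R K ⟩
    sumFin (λ k′ → χ (K k′) * degR R k′)                         ≡⟨ sum-remove K k (degR R) ⟩
    sumFin (λ k′ → χ (remove K k k′) * degR R k′) + χ (K k) * degR R k
      ≡⟨ cong₂ _+_ (sym (edges-by-right R (remove K k))) (χ-weight (K k) _ Kk) ⟩
    edges R (remove K k) + degR R k                              ∎
    where open ≡-Reasoning

  module MinDegreeTwo (R K : Fin n → Bool)
      (degL≥2 : ∀ j → T (R j) → 2 ≤ degL K j)
      (degR≥2 : ∀ k → T (K k) → 2 ≤ degR R k) where

    Active : Vertex n → Set
    Active (inj₁ j) = T (R j)
    Active (inj₂ k) = T (K k)

    record Arc : Set where
      constructor arc
      field
        tail head : Vertex n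
        active    : Active tail × Active head
        adjacent  : Adj H tail head
    open Arc

    continue : (e : Arc) → Σ Arc (λ e′ → tail e′ ≡ head e × head e′ ≢ tail e)
    continue (arc (inj₁ j) (inj₂ k) (_ , Kk) _) =
      let j′ , j′≢j , t = another-point (λ j′ → R j′ ∧ H j′ k) j (degR≥2 k Kk)
          Rj′ , Hj′k    = split-∧ t
      in arc (inj₂ k) (inj₁ j′) (Kk , Rj′) Hj′k , refl , j′≢j ∘ inj₁-injective
    continue (arc (inj₂ k) (inj₁ j) (_ , Rj) _) =
      let k′ , k′≢k , t = another-point (λ k′ → K k′ ∧ H j k′) k (degL≥2 j Rj)
          Kk′ , Hjk′    = split-∧ t
      in arc (inj₁ j) (inj₂ k′) (Rj , Kk′) Hjk′ , refl , k′≢k ∘ inj₂-injective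

    cycle-from : ∀ j k → T (R j) → T (K k) → T (H j k) → Cycle H
    cycle-from j k Rj Kk Hjk = walk⇒cycle H position position-step no-return
      where
      arcs : ℕ → Arc
      arcs zero    = arc (inj₁ j) (inj₂ k) (Rj , Kk) Hjk
      arcs (suc t) = proj₁ (continue (arcs t))

      position : ℕ → Vertex n
      position t = tail (arcs t)

      position-suc : ∀ t → position (suc t) ≡ head (arcs t)
      position-suc t = proj₁ (proj₂ (continue (arcs t)))

      position-step : ∀ t → Adj H (position t) (position (suc t))
      position-step t = subst (Adj H (position t)) (sym (position-suc t)) (adjacent (arcs t))

      no-return : ∀ t → position (suc (suc t)) ≢ position t
      no-return t eq = proj₂ (proj₂ (continue (arcs t))) (trans (sym (position-suc (suc t))) eq)

  -- Deleting a vertex of degree ≤ 1 keeps "more edges than vertices".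
  fewer-edges : ∀ {m e d} → suc m < e + d → d ≤ 1 → m < e
  fewer-edges {m} {e} {d} lt d≤1 =
    ≤-pred (≤-trans lt (≤-trans (+-monoʳ-≤ e d≤1) (≤-reflexive (+-comm e 1))))

  dense⇒cycle : ∀ m R K → order R K ≡ m → m < edges R K → Cycle H
  dense⇒cycle zero R K order≡0 dense =
    let j , _ , Rj , _ = edges-witness R K dense
    in ⊥-elim (1+n≢0 (trans (sym (order-remove-left R K j Rj)) order≡0))
  dense⇒cycle (suc m) R K order≡1+m dense
    with any? (λ j → T? (R j) ×-dec (degL K j ≤? 1)) | any? (λ k → T? (K k) ×-dec (degR R k ≤? 1))
  ... | yes (j , Rj , degj≤1) | _ = dense⇒cycle m (remove R j) K
          (suc-injective (trans (sym (order-remove-left R K j Rj)) order≡1+m))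
          (fewer-edges (subst (suc m <_) (edges-remove-left R K j Rj) dense) degj≤1)
  ... | no _ | yes (k , Kk , degk≤1) = dense⇒cycle m R (remove K k)
          (suc-injective (trans (sym (order-remove-right R K k Kk)) order≡1+m))
          (fewer-edges (subst (suc m <_) (edges-remove-right R K k Kk) dense) degk≤1)
  ... | no no-low-left | no no-low-right =
    let j , k , Rj , Kk , Hjk = edges-witness R K (≤-trans (s≤s z≤n) dense)
    in MinDegreeTwo.cycle-from R K
         (λ j Rj → ≰⇒> (λ deg≤1 → no-low-left (j , Rj , deg≤1)))
         (λ k Kk → ≰⇒> (λ deg≤1 → no-low-right (k , Kk , deg≤1)))
         j k Rj Kk Hjk

many-edges⇒cycle : ∀ {n} (H : Fin n → Fin n → Bool) → n + n < sumFin (λ j → count (H j)) → Cycle H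
many-edges⇒cycle {n} H dense =
  dense⇒cycle (n + n) everything everything (cong₂ _+_ (sumFin-ones {n}) (sumFin-ones {n}))
    (subst (n + n <_) (sumFin-cong (λ j → sym (+-identityʳ (count (H j))))) dense)
  where
  open Peeling H
  everything : Fin n → Bool
  everything _ = true

module Flow {n} (y : ℕ → Vertex n) (ℓ : ℕ) where

  flow : Vertex n → Vertex n → ℕ
  flow u w = sumBelow ℓ (λ a → δ (y a) u * δ (y (suc a)) w)

  flow-out : ∀ u → sumV (flow u) ≡ visits y ℓ u
  flow-out u = begin
    sumV (λ w → sumBelow ℓ (λ a → δ (y a) u * δ (y (suc a)) w))
      ≡⟨ sumV-swap {ℓ} (λ a w → δ (y (toℕ a)) u * δ (y (suc (toℕ a))) w) ⟩
    sumBelow ℓ (λ a → sumV (λ w → δ (y a) u * δ (y (suc a)) w))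
      ≡⟨ sumBelow-cong ℓ (λ a _ → sumV-*ˡ (δ (y a) u) (δ (y (suc a)))) ⟩
    sumBelow ℓ (λ a → δ (y a) u * sumV (δ (y (suc a))))
      ≡⟨ sumBelow-cong ℓ (λ a _ →
           trans (cong (δ (y a) u *_) (sumV-δ (y (suc a)))) (*-identityʳ (δ (y a) u))) ⟩
    visits y ℓ u ∎
    where open ≡-Reasoning

  flow-in : y ℓ ≡ y 0 → ∀ w → sumV (λ u → flow u w) ≡ visits y ℓ w
  flow-in closed w = begin
    sumV (λ u → sumBelow ℓ (λ a → δ (y a) u * δ (y (suc a)) w))
      ≡⟨ sumV-swap {ℓ} (λ a u → δ (y (toℕ a)) u * δ (y (suc (toℕ a))) w) ⟩
    sumBelow ℓ (λ a → sumV (λ u → δ (y a) u * δ (y (suc a)) w))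
      ≡⟨ sumBelow-cong ℓ (λ a _ → sumV-*ʳ (δ (y (suc a)) w) (δ (y a))) ⟩
    sumBelow ℓ (λ a → sumV (δ (y a)) * δ (y (suc a)) w)
      ≡⟨ sumBelow-cong ℓ (λ a _ →
           trans (cong (_* δ (y (suc a)) w) (sumV-δ (y a))) (+-identityʳ _)) ⟩
    sumBelow ℓ (λ a → δ (y (suc a)) w)
      ≡⟨ sumBelow-rotate ℓ (λ a → δ (y a) w) (cong (λ v → δ v w) closed) ⟩
    visits y ℓ w ∎
    where open ≡-Reasoning

  flow≤visits : ∀ u w → flow u w ≤ visits y ℓ u
  flow≤visits u w = sumFin-mono {ℓ} (λ a →
    ≤-trans (*-monoʳ-≤ (δ (y (toℕ a)) u) (δ≤1 (y (suc (toℕ a))) w)) (≤-reflexive (*-identityʳ _)))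

  flow-pos : ∀ u w → 0 < flow u w → ∃ λ a → a < ℓ × y a ≡ u × y (suc a) ≡ w
  flow-pos u w p =
    let a , a<ℓ , q = sumBelow-pos ℓ (λ a → δ (y a) u * δ (y (suc a)) w) p
    in a , a<ℓ , δ-pos (m*n>0⇒m>0 q) , δ-pos (m*n>0⇒n>0 {δ (y a) u} q)
    where
    m*n>0⇒m>0 : ∀ {m k} → 0 < m * k → 0 < m
    m*n>0⇒m>0 {suc m} _ = z<s
    m*n>0⇒n>0 : ∀ {m k} → 0 < m * k → 0 < k
    m*n>0⇒n>0 {m} {suc k} _ = z<s
    m*n>0⇒n>0 {suc m} {zero} p = ⊥-elim (<-irrefl (sym (*-zeroʳ m)) p)

  first-step-once : 3 ≤ ℓ → Distinct y ℓ → flow (y 0) (y 1) ≢ flow (y 1) (y 0)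
  first-step-once ℓ≥3 distinct eq =
    <-irrefl (sym backwards≡0) (≤-trans forwards≥1 (≤-reflexive eq))
    where
    forwards≥1 : 1 ≤ flow (y 0) (y 1)
    forwards≥1 = ≤-trans (≤-reflexive (sym (cong₂ _*_ (δ-refl (y 0)) (δ-refl (y 1)))))
                         (sumBelow-term (λ a → δ (y a) (y 0) * δ (y (suc a)) (y 1))
                                        (≤-trans (s≤s z≤n) ℓ≥3))
    -- Stepping from y 1 to y 0 can only happen at time 1, forcing y 2 = y 0.
    backwards≡0 : flow (y 1) (y 0) ≡ 0
    backwards≡0 = n≤0⇒n≡0 (≮⇒≥ λ p →
      let a , a<ℓ , ya≡y1 , ya+1≡y0 = flow-pos (y 1) (y 0) p
          a≡1 = distinct-injective distinct a<ℓ (≤-trans (s≤s (s≤s z≤n)) ℓ≥3) ya≡y1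
      in distinct 0 2 z<s ℓ≥3 (sym (subst (λ b → y (suc b) ≡ y 0) a≡1 ya+1≡y0)))

balanced-shift : ∀ {n} (p q : Fin n → ℕ) → (∀ x → q x ≤ 1) → sumFin p ≡ sumFin q →
  sumFin (λ x → 1 + p x ∸ q x) ≡ n
balanced-shift {n} p q q≤1 Σp≡Σq = +-cancelʳ-≡ (sumFin q) _ _ (begin
  sumFin (λ x → 1 + p x ∸ q x) + sumFin q  ≡⟨ sym (sumFin-+ (λ x → 1 + p x ∸ q x) q) ⟩
  sumFin (λ x → (1 + p x ∸ q x) + q x)
    ≡⟨ sumFin-cong (λ x → m∸n+n≡m (≤-trans (q≤1 x) (m≤m+n 1 (p x)))) ⟩
  sumFin (λ x → 1 + p x)                   ≡⟨ sumFin-+ (λ _ → 1) p ⟩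
  sumFin {n} (λ _ → 1) + sumFin p          ≡⟨ cong₂ _+_ (sumFin-ones {n}) Σp≡Σq ⟩
  n + sumFin q                             ∎)
  where open ≡-Reasoning

opposite-shifts : ∀ p q → p ≤ 1 → q ≤ 1 → (1 + p ∸ q) + (1 + q ∸ p) ≡ 2
opposite-shifts 0 0 _ _ = refl
opposite-shifts 0 1 _ _ = refl
opposite-shifts 1 0 _ _ = refl
opposite-shifts 1 1 _ _ = refl
opposite-shifts (suc (suc _)) _ (s≤s ()) _
opposite-shifts _ (suc (suc _)) _ (s≤s ())

shift≡1⇒equal : ∀ p q → 1 + p ∸ q ≡ 1 → p ≡ q
shift≡1⇒equal p       zero    eq = suc-injective eq
shift≡1⇒equal zero    (suc q) eq with () ← trans (sym (0∸n≡0 q)) eq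
shift≡1⇒equal (suc p) (suc q) eq = cong suc (shift≡1⇒equal p q eq)

two-point-sum : ∀ {n} (f : Fin n → ℕ) i₁ i₂ → i₁ ≢ i₂ → f i₁ + f i₂ ≡ 2 →
  (∀ i → i ≢ i₁ → i ≢ i₂ → f i ≡ 1) → sumFin f ≡ n
two-point-sum {n} f i₁ i₂ i₁≢i₂ sum≡2 elsewhere≡1 = +-cancelʳ-≡ 2 _ _ (begin
  sumFin f + 2
    ≡⟨ cong (sumFin f +_) (sym (cong₂ _+_ (sumFin-unit i₁) (sumFin-unit i₂))) ⟩
  sumFin f + (sumFin (δ i₁) + sumFin (δ i₂))
    ≡⟨ cong (sumFin f +_) (sym (sumFin-+ (δ i₁) (δ i₂))) ⟩
  sumFin f + sumFin (λ i → δ i₁ i + δ i₂ i)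
    ≡⟨ sym (sumFin-+ f _) ⟩
  sumFin (λ i → f i + (δ i₁ i + δ i₂ i))
    ≡⟨ sumFin-cong pointwise ⟩
  sumFin (λ i → 1 + (δ i₁ i * f i₁ + δ i₂ i * f i₂))
    ≡⟨ sumFin-+ (λ _ → 1) (λ i → δ i₁ i * f i₁ + δ i₂ i * f i₂) ⟩
  sumFin {n} (λ _ → 1) + sumFin (λ i → δ i₁ i * f i₁ + δ i₂ i * f i₂)
    ≡⟨ cong₂ _+_ (sumFin-ones {n}) (trans (sumFin-+ (λ i → δ i₁ i * f i₁) _)
                   (cong₂ _+_ (sumFin-δ i₁ (λ _ → f i₁)) (sumFin-δ i₂ (λ _ → f i₂)))) ⟩
  n + (f i₁ + f i₂)
    ≡⟨ cong (n +_) sum≡2 ⟩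
  n + 2 ∎)
  where
  open ≡-Reasoning
  pointwise : ∀ i → f i + (δ i₁ i + δ i₂ i) ≡ 1 + (δ i₁ i * f i₁ + δ i₂ i * f i₂)
  pointwise i with i₁ ≟ i | i₂ ≟ i
  ... | yes refl | yes refl = ⊥-elim (i₁≢i₂ refl)
  ... | yes refl | no _     = trans (+-comm (f i) 1) (cong suc (sym (trans (+-identityʳ _) (+-identityʳ (f i)))))
  ... | no _     | yes refl = trans (+-comm (f i) 1) (cong suc (sym (+-identityʳ (f i))))
  ... | no i₁≢i  | no i₂≢i  = cong (_+ 0) (elsewhere≡1 i (i₁≢i ∘ sym) (i₂≢i ∘ sym))

missing : ∀ {n} → SubsetArray n → Fin n → Fin n → Fin n → Bool
missing D i j k = not (lookup (D i j) k)

∈⇒not-missing : ∀ {n} (D : SubsetArray n) {i j k} → k ∈ D i j → ¬ T (missing D i j k)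
∈⇒not-missing D k∈Dij missing rewrite []=⇒lookup k∈Dij = missing

-- A trade for D between rows i₁ ≠ i₂: in cell (i₁, j) the multiplicity of
-- symbol k becomes 1 + P j k − Q j k, in cell (i₂, j) it becomes
-- 1 + Q j k − P j k.  The balance conditions keep all line sums equal to n,
-- the support conditions keep D contained, and nontriviality makes the new
-- square differ from the full one.
record Trade {n} (D : SubsetArray n) (i₁ i₂ : Fin n) : Set where
  field
    P Q            : Fin n → Fin n → ℕ
    P≤1            : ∀ j k → P j k ≤ 1
    Q≤1            : ∀ j k → Q j k ≤ 1
    cell-balance   : ∀ j → sumFin (P j) ≡ sumFin (Q j)
    symbol-balance : ∀ k → sumFin (λ j → P j k) ≡ sumFin (λ j → Q j k)
    keeps-row₁     : ∀ j k → k ∈ D i₁ j → Q j k ≡ 0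
    keeps-row₂     : ∀ j k → k ∈ D i₂ j → P j k ≡ 0
    nontrivial     : ∃ λ j → ∃ λ k → P j k ≢ Q j k

module TradedSquare {n} {D : SubsetArray n} {i₁ i₂ : Fin n}
                    (i₁≢i₂ : i₁ ≢ i₂) (t : Trade D i₁ i₂) where
  open Trade t

  traded : Array n
  traded i j k with i ≟ i₁ | i ≟ i₂
  ... | yes _ | _     = 1 + P j k ∸ Q j k
  ... | no _  | yes _ = 1 + Q j k ∸ P j k
  ... | no _  | no _  = 1

  traded-row₁ : ∀ j k → traded i₁ j k ≡ 1 + P j k ∸ Q j k
  traded-row₁ j k with i₁ ≟ i₁
  ... | yes _    = refl
  ... | no i₁≢i₁ = ⊥-elim (i₁≢i₁ refl)

  traded-row₂ : ∀ j k → traded i₂ j k ≡ 1 + Q j k ∸ P j k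
  traded-row₂ j k with i₂ ≟ i₁ | i₂ ≟ i₂
  ... | yes i₂≡i₁ | _        = ⊥-elim (i₁≢i₂ (sym i₂≡i₁))
  ... | no _      | yes _    = refl
  ... | no _      | no i₂≢i₂ = ⊥-elim (i₂≢i₂ refl)

  traded-other : ∀ i j k → i ≢ i₁ → i ≢ i₂ → traded i j k ≡ 1
  traded-other i j k i≢i₁ i≢i₂ with i ≟ i₁ | i ≟ i₂
  ... | yes i≡i₁ | _        = ⊥-elim (i≢i₁ i≡i₁)
  ... | no _     | yes i≡i₂ = ⊥-elim (i≢i₂ i≡i₂)
  ... | no _     | no _     = refl

  data RowKind (i : Fin n) : Set where
    first  : i ≡ i₁ → RowKind i
    second : i ≡ i₂ → RowKind i
    other  : i ≢ i₁ → i ≢ i₂ → RowKind i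

  row-kind : ∀ i → RowKind i
  row-kind i with i ≟ i₁ | i ≟ i₂
  ... | yes i≡i₁ | _        = first i≡i₁
  ... | no _     | yes i≡i₂ = second i≡i₂
  ... | no i≢i₁  | no i≢i₂  = other i≢i₁ i≢i₂

  traded-latin : IsLatin n traded
  traded-latin = cells , rows , columns
    where
    cells : ∀ i j → sumFin (λ k → traded i j k) ≡ n
    cells i j with row-kind i
    ... | first refl  = trans (sumFin-cong (traded-row₁ j))
                          (balanced-shift (P j) (Q j) (Q≤1 j) (cell-balance j))
    ... | second refl = trans (sumFin-cong (traded-row₂ j))
                          (balanced-shift (Q j) (P j) (P≤1 j) (sym (cell-balance j)))
    ... | other i≢i₁ i≢i₂ =
      trans (sumFin-cong (λ k → traded-other i j k i≢i₁ i≢i₂)) (sumFin-ones {n})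
    rows : ∀ i k → sumFin (λ j → traded i j k) ≡ n
    rows i k with row-kind i
    ... | first refl  = trans (sumFin-cong (λ j → traded-row₁ j k))
                          (balanced-shift (λ j → P j k) (λ j → Q j k) (λ j → Q≤1 j k) (symbol-balance k))
    ... | second refl = trans (sumFin-cong (λ j → traded-row₂ j k))
                          (balanced-shift (λ j → Q j k) (λ j → P j k) (λ j → P≤1 j k)
                                          (sym (symbol-balance k)))
    ... | other i≢i₁ i≢i₂ =
      trans (sumFin-cong (λ j → traded-other i j k i≢i₁ i≢i₂)) (sumFin-ones {n})
    columns : ∀ j k → sumFin (λ i → traded i j k) ≡ n
    columns j k = two-point-sum (λ i → traded i j k) i₁ i₂ i₁≢i₂
      (trans (cong₂ _+_ (traded-row₁ j k) (traded-row₂ j k))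
             (opposite-shifts (P j k) (Q j k) (P≤1 j k) (Q≤1 j k)))
      (λ i → traded-other i j k)

  traded-contains : Contains traded D
  traded-contains i j k k∈Dij with row-kind i
  ... | first refl  = ≤-trans (s≤s z≤n) (≤-reflexive (sym
                        (trans (traded-row₁ j k) (cong (1 + P j k ∸_) (keeps-row₁ j k k∈Dij)))))
  ... | second refl = ≤-trans (s≤s z≤n) (≤-reflexive (sym
                        (trans (traded-row₂ j k) (cong (1 + Q j k ∸_) (keeps-row₂ j k k∈Dij)))))
  ... | other i≢i₁ i≢i₂ = ≤-reflexive (sym (traded-other i j k i≢i₁ i≢i₂))

  not-defining : ¬ IsDefiningSetFull n D
  not-defining defining =
    let j , k , P≢Q = nontrivial
    in P≢Q (shift≡1⇒equal (P j k) (Q j k)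
             (trans (sym (traded-row₁ j k)) (defining traded traded-latin traded-contains i₁ j k)))

commonGaps : ∀ {n} → SubsetArray n → Fin n → Fin n → Fin n → Fin n → Bool
commonGaps D i₁ i₂ j k = missing D i₁ j k ∧ missing D i₂ j k

-- A cycle of common gaps is a trade: symbol k moves into row i₁ at column j
-- when the cycle steps from j to k (P), and into row i₂ when it steps from k
-- to j (Q).  Flow conservation gives the balance conditions.
module CycleTrade {n} (D : SubsetArray n) (i₁ i₂ : Fin n)
                  (C : Cycle (commonGaps D i₁ i₂)) where
  open Cycle C
  open Flow vertex length

  H : Fin n → Fin n → Bool
  H = commonGaps D i₁ i₂

  P Q : Fin n → Fin n → ℕ
  P j k = flow (inj₁ j) (inj₂ k)
  Q j k = flow (inj₂ k) (inj₁ j)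

  flow≤1 : ∀ u w → flow u w ≤ 1
  flow≤1 u w = ≤-trans (flow≤visits u w) (visits≤1 vertex length distinct u)

  flow-off-edges : ∀ u w → ¬ Adj H u w → flow u w ≡ 0
  flow-off-edges u w ¬adj = n≤0⇒n≡0 (≮⇒≥ λ p →
    let a , a<ℓ , ya≡u , ya+1≡w = flow-pos u w p
    in ¬adj (subst₂ (Adj H) ya≡u ya+1≡w (step a a<ℓ)))

  no-flow-between-columns : ∀ j j′ → flow (inj₁ j) (inj₁ j′) ≡ 0
  no-flow-between-columns _ _ = flow-off-edges _ _ λ ()

  no-flow-between-symbols : ∀ k k′ → flow (inj₂ k) (inj₂ k′) ≡ 0
  no-flow-between-symbols _ _ = flow-off-edges _ _ λ ()

  cell-balance : ∀ j → sumFin (P j) ≡ sumFin (Q j)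
  cell-balance j = begin
    sumFin (P j)                   ≡⟨ sym (sumV-right (flow (inj₁ j)) (no-flow-between-columns j)) ⟩
    sumV (flow (inj₁ j))           ≡⟨ flow-out (inj₁ j) ⟩
    visits vertex length (inj₁ j)  ≡⟨ sym (flow-in closed (inj₁ j)) ⟩
    sumV (λ u → flow u (inj₁ j))   ≡⟨ sumV-right (λ u → flow u (inj₁ j)) (λ j′ → no-flow-between-columns j′ j) ⟩
    sumFin (Q j)                   ∎
    where open ≡-Reasoning

  symbol-balance : ∀ k → sumFin (λ j → P j k) ≡ sumFin (λ j → Q j k)
  symbol-balance k = begin
    sumFin (λ j → P j k)           ≡⟨ sym (sumV-left (λ u → flow u (inj₂ k)) (λ k′ → no-flow-between-symbols k′ k)) ⟩
    sumV (λ u → flow u (inj₂ k))   ≡⟨ flow-in closed (inj₂ k) ⟩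
    visits vertex length (inj₂ k)  ≡⟨ sym (flow-out (inj₂ k)) ⟩
    sumV (flow (inj₂ k))           ≡⟨ sumV-left (flow (inj₂ k)) (no-flow-between-symbols k) ⟩
    sumFin (λ j → Q j k)           ∎
    where open ≡-Reasoning

  keeps-row₁ : ∀ j k → k ∈ D i₁ j → Q j k ≡ 0
  keeps-row₁ j k k∈Dij = flow-off-edges _ _ (∈⇒not-missing D k∈Dij ∘ proj₁ ∘ split-∧)

  keeps-row₂ : ∀ j k → k ∈ D i₂ j → P j k ≡ 0
  keeps-row₂ j k k∈Dij = flow-off-edges _ _ (∈⇒not-missing D k∈Dij ∘ proj₂ ∘ split-∧)

  -- The first edge of the cycle is used in one direction only.
  nontrivial : ∃ λ j → ∃ λ k → P j k ≢ Q j k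
  nontrivial = orient (vertex 0) (vertex 1) (step 0 (≤-trans (s≤s z≤n) long))
                      (first-step-once long distinct)
    where
    orient : ∀ u w → Adj H u w → flow u w ≢ flow w u → ∃ λ j → ∃ λ k → P j k ≢ Q j k
    orient (inj₁ j) (inj₂ k) _ ≢ = j , k , ≢
    orient (inj₂ k) (inj₁ j) _ ≢ = j , k , ≢ ∘ sym

  trade : Trade D i₁ i₂
  trade = record
    { P = P ; Q = Q
    ; P≤1 = λ j k → flow≤1 _ _ ; Q≤1 = λ j k → flow≤1 _ _
    ; cell-balance = cell-balance ; symbol-balance = symbol-balance
    ; keeps-row₁ = keeps-row₁ ; keeps-row₂ = keeps-row₂
    ; nontrivial = nontrivial
    }

common-gaps≤2n : ∀ {n} (D : SubsetArray n) → IsDefiningSetFull n D → ∀ i₁ i₂ → i₁ ≢ i₂ →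
  sumFin (λ j → count (commonGaps D i₁ i₂ j)) ≤ n + n
common-gaps≤2n D defining i₁ i₂ i₁≢i₂ = ≮⇒≥ λ dense →
  TradedSquare.not-defining i₁≢i₂ (CycleTrade.trade D i₁ i₂ (many-edges⇒cycle _ dense)) defining

sumFin-swap₃ : ∀ {a b c} (F : Fin a → Fin b → Fin c → ℕ) →
  sumFin (λ x → sumFin (λ y → sumFin (λ z → F x y z))) ≡
  sumFin (λ z → sumFin (λ x → sumFin (λ y → F x y z)))
sumFin-swap₃ F = trans (sumFin-cong (λ x → sumFin-swap (λ y z → F x y z)))
                       (sumFin-swap (λ x z → sumFin (λ y → F x y z)))

cell-complement : ∀ {n} (p : Subset n) → ∣ p ∣ + count (λ k → not (lookup p k)) ≡ n
cell-complement []           = refl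
cell-complement (true ∷ p)  = cong suc (cell-complement p)
cell-complement (false ∷ p) = trans (+-suc _ _) (cong suc (cell-complement p))

deficiency : ∀ {n} → SubsetArray n → ℕ
deficiency D = sumFin (λ i → sumFin (λ j → count (missing D i j)))

size+deficiency : ∀ {n} (D : SubsetArray n) → size D + deficiency D ≡ n ^ 3
size+deficiency {n} D = begin
  size D + deficiency D
    ≡⟨ sym (sumFin-+ (λ i → sumFin (λ j → ∣ D i j ∣)) _) ⟩
  sumFin (λ i → sumFin (λ j → ∣ D i j ∣) + sumFin (λ j → count (missing D i j)))
    ≡⟨ sumFin-cong (λ i → sym (sumFin-+ (λ j → ∣ D i j ∣) _)) ⟩
  sumFin (λ i → sumFin (λ j → ∣ D i j ∣ + count (missing D i j)))
    ≡⟨ sumFin-cong (λ i → trans (sumFin-cong (λ j → cell-complement (D i j))) (sumFin-const {n} n)) ⟩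
  sumFin {n} (λ i → n * n)
    ≡⟨ sumFin-const {n} (n * n) ⟩
  n * (n * n)
    ≡⟨ cong (λ m → n * (n * m)) (sym (*-identityʳ n)) ⟩
  n ^ 3 ∎
  where open ≡-Reasoning

gaps : ∀ {n} → SubsetArray n → Fin n → Fin n → ℕ
gaps D j k = sumFin (λ i → χ (missing D i j k))

deficiency-by-gaps : ∀ {n} (D : SubsetArray n) → deficiency D ≡ sumFin (λ j → sumFin (gaps D j))
deficiency-by-gaps D =
  trans (sumFin-swap (λ i j → count (missing D i j)))
        (sumFin-cong (λ j → sumFin-swap (λ i k → χ (missing D i j k))))

row-overlap : ∀ {n} → SubsetArray n → Fin n → Fin n → ℕ
row-overlap D i₁ i₂ = sumFin (λ j → sumFin (λ k → χ (missing D i₁ j k) * χ (missing D i₂ j k)))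

gaps²-by-overlaps : ∀ {n} (D : SubsetArray n) →
  sumFin (λ j → sumFin (λ k → gaps D j k * gaps D j k)) ≡
  sumFin (λ i₁ → sumFin (λ i₂ → row-overlap D i₁ i₂))
gaps²-by-overlaps {n} D = begin
  sumFin (λ j → sumFin (λ k → gaps D j k * gaps D j k))
    ≡⟨ sumFin-cong (λ j → sumFin-cong (λ k → sumFin-mul (λ i → e i j k) (λ i → e i j k))) ⟩
  sumFin (λ j → sumFin (λ k → sumFin (λ i₁ → sumFin (λ i₂ → e i₁ j k * e i₂ j k))))
    ≡⟨ sumFin-swap₃ (λ j k i₁ → sumFin (λ i₂ → e i₁ j k * e i₂ j k)) ⟩
  sumFin (λ i₁ → sumFin (λ j → sumFin (λ k → sumFin (λ i₂ → e i₁ j k * e i₂ j k))))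
    ≡⟨ sumFin-cong (λ i₁ → sumFin-swap₃ (λ j k i₂ → e i₁ j k * e i₂ j k)) ⟩
  sumFin (λ i₁ → sumFin (λ i₂ → row-overlap D i₁ i₂)) ∎
  where
  open ≡-Reasoning
  e : Fin n → Fin n → Fin n → ℕ
  e i j k = χ (missing D i j k)

row-overlap-bound : ∀ {n} (D : SubsetArray n) → IsDefiningSetFull n D →
  ∀ i₁ i₂ → row-overlap D i₁ i₂ ≤ δ i₁ i₂ * (n * n) + (n + n)
row-overlap-bound {n} D defining i₁ i₂ with i₁ ≟ i₂
... | yes refl = begin
  row-overlap D i₁ i₁
    ≤⟨ sumFin-mono (λ j → sumFin-mono (λ k → χ²≤1 (missing D i₁ j k))) ⟩
  sumFin {n} (λ j → sumFin {n} (λ k → 1))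
    ≡⟨ trans (sumFin-cong {n} (λ j → sumFin-ones {n})) (sumFin-const {n} n) ⟩
  n * n
    ≡⟨ sym (+-identityʳ (n * n)) ⟩
  1 * (n * n)
    ≤⟨ m≤m+n _ (n + n) ⟩
  1 * (n * n) + (n + n) ∎
  where
  open ≤-Reasoning
  χ²≤1 : ∀ b → χ b * χ b ≤ 1
  χ²≤1 true  = s≤s z≤n
  χ²≤1 false = z≤n
... | no i₁≢i₂ = begin
  row-overlap D i₁ i₂
    ≡⟨ sumFin-cong (λ j → sumFin-cong (λ k → sym (χ-∧ (missing D i₁ j k) (missing D i₂ j k)))) ⟩
  sumFin (λ j → count (commonGaps D i₁ i₂ j))  ≤⟨ common-gaps≤2n D defining i₁ i₂ i₁≢i₂ ⟩
  n + n                                        ≤⟨ m≤n+m (n + n) (0 * (n * n)) ⟩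
  0 * (n * n) + (n + n)                        ∎
  where open ≤-Reasoning

-- Cauchy–Schwarz over the n² pairs (j,k) bounds the squared deficiency by 3n⁵.
deficiency²-bound : ∀ {n} (D : SubsetArray n) → IsDefiningSetFull n D →
  deficiency D * deficiency D ≤ n * (n * (n * (n * n + n * (n + n))))
deficiency²-bound {n} D defining = begin
  deficiency D * deficiency D
    ≡⟨ cong₂ _*_ (deficiency-by-gaps D) (deficiency-by-gaps D) ⟩
  sumFin (λ j → sumFin (gaps D j)) * sumFin (λ j → sumFin (gaps D j))
    ≤⟨ cauchy-schwarz² (gaps D) ⟩
  n * (n * sumFin (λ j → sumFin (λ k → gaps D j k * gaps D j k)))
    ≡⟨ cong (λ m → n * (n * m)) (gaps²-by-overlaps D) ⟩
  n * (n * sumFin (λ i₁ → sumFin (λ i₂ → row-overlap D i₁ i₂)))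
    ≤⟨ *-monoʳ-≤ n (*-monoʳ-≤ n (sumFin-mono {n} (λ i₁ → sumFin-mono {n} (λ i₂ →
         row-overlap-bound D defining i₁ i₂)))) ⟩
  n * (n * sumFin {n} (λ i₁ → sumFin {n} (λ i₂ → δ i₁ i₂ * (n * n) + (n + n))))
    ≡⟨ cong (λ m → n * (n * m)) total ⟩
  n * (n * (n * (n * n + n * (n + n)))) ∎
  where
  open ≤-Reasoning
  total : sumFin {n} (λ i₁ → sumFin {n} (λ i₂ → δ i₁ i₂ * (n * n) + (n + n))) ≡
          n * (n * n + n * (n + n))
  total = trans (sumFin-cong {n} (λ i₁ → trans (sumFin-+ (λ i₂ → δ i₁ i₂ * (n * n)) (λ _ → n + n))
                  (cong₂ _+_ (sumFin-δ i₁ (λ _ → n * n)) (sumFin-const {n} (n + n)))))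
                (sumFin-const {n} (n * n + n * (n + n)))

three-n⁵≤four-n⁵ : ∀ n → n * (n * (n * (n * n + n * (n + n)))) ≤ 2 * 2 * n ^ 5
three-n⁵≤four-n⁵ n = ≤-trans (m≤m+n _ (n ^ 5)) (≤-reflexive
  (solve 1 (λ n → n :* (n :* (n :* (n :* n :+ n :* (n :+ n)))) :+ n :* (n :* (n :* (n :* (n :* con 1))))
                  := con 2 :* con 2 :* (n :* (n :* (n :* (n :* (n :* con 1)))))) refl n))
  where open +-*-Solver

corollary2p3 : Σ ℕ (λ C → ∀ (n : ℕ) → 2 ≤ n → (D : SubsetArray n) → IsDefiningSetFull n D →
                 ((n ^ 3 ∸ size D) ^ 2 ≤ C * C * n ^ 5) × (size D ≤ n ^ 3))
corollary2p3 = 2 , λ n _ D defining →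
  (begin
    (n ^ 3 ∸ size D) ^ 2                     ≡⟨ cong (λ m → (m ∸ size D) ^ 2) (sym (size+deficiency D)) ⟩
    (size D + deficiency D ∸ size D) ^ 2     ≡⟨ cong (_^ 2) (m+n∸m≡n (size D) (deficiency D)) ⟩
    deficiency D ^ 2                         ≡⟨ cong (deficiency D *_) (*-identityʳ (deficiency D)) ⟩
    deficiency D * deficiency D              ≤⟨ deficiency²-bound D defining ⟩
    n * (n * (n * (n * n + n * (n + n))))    ≤⟨ three-n⁵≤four-n⁵ n ⟩
    2 * 2 * n ^ 5                            ∎)
  , subst (size D ≤_) (size+deficiency D) (m≤m+n (size D) (deficiency D))
  where open ≤-Reasoning
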